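{- Let $G=(V,E)$ be an undirected graph with positive capacities $c_G$, let $s\neq t\in V$, $\epsilon>0$, let $f_i$ be a nonnegative vector on the arcs of $\overleftrightarrow G$, and let $S_i\subseteq V$ with $s\in S_i$, $t\notin S_i$. Define $\vec U_i$, $G_i$, $G'_i$ and $\tau_i=0.5\,c_{G'_i}(\vec\partial S_i)$ from $(f_i,S_i)$ as in the context. Suppose $h$ is a feasible flow in $G'_i$ routing a demand $d$ such that $\tau_i(\mathbbm 1_s-\mathbbm 1_t)-d$ can be routed in $G_i$ with congestion at most $\epsilon$. Set $f_{i+1}=f_i+h$ (viewing $h$ as a vector on arcs of $\overleftrightarrow G$, zero outside the arcs of $G'_i$) and $S_{i+1}=S_i$, and define $G'_{i+1}$ from $(f_{i+1},S_{i+1})$ by the same rules. Then $c_{G'_{i+1}}(\vec\partial S_{i+1})\le 0.75\,c_{G'_i}(\vec\partial S_i)$.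
   Context: For an undirected graph $H$ with capacities $c_H$, $\overleftrightarrow H$ is the directed graph with arcs $(u,v),(v,u)$ of capacity $c_H(u,v)$ for each edge $\{u,v\}$. For a directed graph and $S\subseteq V$, $\vec\partial S$ is the set of arcs with tail in $S$ and head not in $S$; for an undirected graph, $\partial S$ is the set of edges with exactly one endpoint in $S$; $c(F)$ is the total capacity of $F$. A flow in a directed graph is a nonnegative arc vector; it is feasible if it is at most the capacity on every arc; its congestion is the max ratio flow/capacity; it routes demand $d$ if the net outflow at every $v$ is $d_v$. The residual graph of an undirected graph $H$ for a nonnegative vector $f$ on arcs of $\overleftrightarrow H$ is the directed graph with capacity $c_H(u,v)-f(u,v)+f(v,u)$ on each ordered pair $(u,v)$ with $\{u,v\}$ an edge of $H$. Construction from $(f_i,S_i)$: $\vec U_i$ is the set of arcs $(u,v)\in\vec\partial S_i$ of $\overleftrightarrow G$ with $f_i(u,v)\le(1-4\epsilon)c_G(u,v)$; $U_i$ is the set of undirected edges underlying $\vec U_i$; $G_i$ is the undirected graph $G$ with the edges of $\partial S_i\setminus U_i$ removed; $f_i|_{G_i}$ is $f_i$ with entries on arcs outside $\overleftrightarrow{G_i}$ set to zero; $G'_i$ is the residual graph of $G_i$ for $f_i|_{G_i}$.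
   Formalization: The capacities $c_G$, the vector $f_i$, the flow $h$, the demand $d$, the flow of congestion at most ε in $G_i$, and ε itself take values in ℚ rather than ℝ. -}

module Defs where

open import Data.Nat using (ℕ; zero; suc)
open import Data.Fin using (Fin; zero; suc; _≟_)
open import Data.Bool using (Bool; true; false; _∧_; _∨_; not; if_then_else_; _xor_)
open import Data.Integer using (+_)
open import Data.Rational using (ℚ; 0ℚ; 1ℚ; ½; _+_; _-_; _*_; -_; _/_; _≤ᵇ_)
open import Relation.Nullary.Decidable using (⌊_⌋)

sumFin : ∀ {n} → (Fin n → ℚ) → ℚ
sumFin {zero}  g = 0ℚ
sumFin {suc n} g = g zero + sumFin (λ i → g (suc i))

-- A graph on vertex set Fin n is given by a (symmetric) adjacency relation
-- adj : Fin n → Fin n → Bool; capacities are c : Fin n → Fin n → ℚ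
-- (only meaningful on edges).  Vectors on arcs of the bidirected graph are
-- functions Fin n → Fin n → ℚ (only meaningful on arcs).

Adj : ℕ → Set
Adj n = Fin n → Fin n → Bool

ArcVec : ℕ → Set
ArcVec n = Fin n → Fin n → ℚ

VSet : ℕ → Set
VSet n = Fin n → Bool

module _ {n : ℕ} where

  leaves : VSet n → Fin n → Fin n → Bool
  leaves S u v = S u ∧ not (S v)

  crosses : VSet n → Fin n → Fin n → Bool
  crosses S u v = S u xor S v

  restrict : Adj n → ArcVec n → ArcVec n
  restrict a f u v = if a u v then f u v else 0ℚ

  Uarc : Adj n → ArcVec n → ℚ → ArcVec n → VSet n → Fin n → Fin n → Bool
  Uarc adj c ε f S u v =
    adj u v ∧ leaves S u v ∧ (f u v ≤ᵇ ((1ℚ - (+ 4 / 1) * ε) * c u v))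

  Uedge : Adj n → ArcVec n → ℚ → ArcVec n → VSet n → Fin n → Fin n → Bool
  Uedge adj c ε f S u v = Uarc adj c ε f S u v ∨ Uarc adj c ε f S v u

  Gi : Adj n → ArcVec n → ℚ → ArcVec n → VSet n → Adj n
  Gi adj c ε f S u v =
    adj u v ∧ not (crosses S u v ∧ not (Uedge adj c ε f S u v))

  residCap : ArcVec n → ArcVec n → ArcVec n
  residCap c g u v = c u v - g u v + g v u

  G'cap : Adj n → ArcVec n → ℚ → ArcVec n → VSet n → ArcVec n
  G'cap adj c ε f S = residCap c (restrict (Gi adj c ε f S) f)

  cutCap : Adj n → ArcVec n → VSet n → ℚ
  cutCap a k S =
    sumFin (λ u → sumFin (λ v → if a u v ∧ leaves S u v then k u v else 0ℚ))

  residCut : Adj n → ArcVec n → ℚ → ArcVec n → VSet n → ℚ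
  residCut adj c ε f S = cutCap (Gi adj c ε f S) (G'cap adj c ε f S) S

  netOut : Adj n → ArcVec n → Fin n → ℚ
  netOut a g v =
    sumFin (λ w → if a v w then g v w else 0ℚ) - sumFin (λ w → if a w v then g w v else 0ℚ)

  stDemand : ℚ → Fin n → Fin n → Fin n → ℚ
  stDemand τ s t v =
    if ⌊ v ≟ s ⌋ then τ else (if ⌊ v ≟ t ⌋ then - τ else 0ℚ)

-- Let C = c_{G'_i}(∂⃗S) and, for an arc vector k, let k(∂⃗S) be the net flow k(u,v) − k(v,u)
-- summed over the arcs (u,v) of G_i leaving S.  Since h vanishes off G_i, f and hence U⃗ are
-- unchanged on arcs outside G_i, so every arc of G_{i+1} leaving S is an arc of G_i; on such an
-- arc augmenting by h lowers the residual capacity by exactly the net h-flow, and an arc that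
-- drops out of G_i still had residual capacity at least its net h-flow.  Hence
-- c_{G'_{i+1}}(∂⃗S) ≤ C − h(∂⃗S).  As h and g together route τ(1_s − 1_t), flow conservation
-- gives h(∂⃗S) + g(∂⃗S) = τ = C/2.  An arc of G_i leaving S lies in U⃗_i, so its residual
-- capacity is at least c − (1 − 4ε)c = 4εc, four times the most g can send across it; thus
-- g(∂⃗S) ≤ C/4 and the new cut is at most C − C/2 + C/4 = 3C/4.

module Submission where

open import Defs
open import Data.Nat using (ℕ; zero; suc)
open import Data.Fin using (Fin; zero; suc; _≟_)
open import Data.Fin.Properties using (suc-injective)
open import Data.Bool using (true; false; _∧_; not; if_then_else_)
open import Data.Bool.Properties
  using (xor-comm; ∨-comm; ∧-identityʳ; ∧-zeroʳ; ∨-identityʳ; not-involutive; ∧-conicalˡ; ∧-conicalʳ; T-≡; if-eta; ¬-not)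
open import Data.Integer using (+_)
open import Data.Rational using (ℚ; 0ℚ; 1ℚ; ½; _+_; _-_; _*_; _/_; _≤_; _<_; _≤ᵇ_)
open import Data.Rational.Properties
  using (≤-refl; ≤-reflexive; +-mono-≤; +-monoˡ-≤; +-monoʳ-≤; *-monoˡ-≤-nonNeg; neg-antimono-≤;
         +-identityˡ; +-identityʳ; +-inverseʳ; *-zeroʳ; *-distribˡ-+; ≤ᵇ⇒≤; module ≤-Reasoning)
open import Data.Rational.Solver using (module +-*-Solver)
open import Data.Product using (Σ; _×_; _,_; proj₁; proj₂)
open import Function using (_∘_; Equivalence)
open import Relation.Binary.PropositionalEquality
open import Relation.Nullary using (yes; no)
open import Relation.Nullary.Negation using (contradiction)

open +-*-Solver using (solve; _:=_; _:+_; _:-_; _:*_; con)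

p≤p+q : ∀ p {q} → 0ℚ ≤ q → p ≤ p + q
p≤p+q p 0≤q = subst (_≤ p + _) (+-identityʳ p) (+-monoʳ-≤ p 0≤q)

p-q≤p : ∀ p {q} → 0ℚ ≤ q → p - q ≤ p
p-q≤p p 0≤q = subst (p - _ ≤_) (+-identityʳ p) (+-monoʳ-≤ p (neg-antimono-≤ 0≤q))

sumFin-cong : ∀ {m} {x y : Fin m → ℚ} → (∀ i → x i ≡ y i) → sumFin x ≡ sumFin y
sumFin-cong {zero}  _   = refl
sumFin-cong {suc m} x≗y = cong₂ _+_ (x≗y zero) (sumFin-cong (x≗y ∘ suc))

sumFin-zero : ∀ m → sumFin {m} (λ _ → 0ℚ) ≡ 0ℚ
sumFin-zero zero    = refl
sumFin-zero (suc m) = trans (+-identityˡ _) (sumFin-zero m)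

sumFin-distrib-+ : ∀ {m} (x y : Fin m → ℚ) → sumFin (λ i → x i + y i) ≡ sumFin x + sumFin y
sumFin-distrib-+ {zero}  x y = refl
sumFin-distrib-+ {suc m} x y =
  trans (cong (_+_ (x zero + y zero)) (sumFin-distrib-+ (x ∘ suc) (y ∘ suc)))
        (solve 4 (λ a b c d → (a :+ b) :+ (c :+ d) := (a :+ c) :+ (b :+ d)) refl
               (x zero) (y zero) (sumFin (x ∘ suc)) (sumFin (y ∘ suc)))

sumFin-distrib-minus : ∀ {m} (x y : Fin m → ℚ) → sumFin (λ i → x i - y i) ≡ sumFin x - sumFin y
sumFin-distrib-minus {zero}  x y = refl
sumFin-distrib-minus {suc m} x y =
  trans (cong (_+_ (x zero - y zero)) (sumFin-distrib-minus (x ∘ suc) (y ∘ suc)))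
        (solve 4 (λ a b c d → (a :- b) :+ (c :- d) := (a :+ c) :- (b :+ d)) refl
               (x zero) (y zero) (sumFin (x ∘ suc)) (sumFin (y ∘ suc)))

*-distribˡ-sumFin : ∀ {m} q (x : Fin m → ℚ) → q * sumFin x ≡ sumFin (λ i → q * x i)
*-distribˡ-sumFin {zero}  q x = *-zeroʳ q
*-distribˡ-sumFin {suc m} q x =
  trans (*-distribˡ-+ q (x zero) _) (cong (_+_ (q * x zero)) (*-distribˡ-sumFin q (x ∘ suc)))

sumFin-mono-≤ : ∀ {m} {x y : Fin m → ℚ} → (∀ i → x i ≤ y i) → sumFin x ≤ sumFin y
sumFin-mono-≤ {zero}  _   = ≤-refl
sumFin-mono-≤ {suc m} x≤y = +-mono-≤ (x≤y zero) (sumFin-mono-≤ (x≤y ∘ suc))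

sumFin-comm : ∀ {m k} (F : Fin m → Fin k → ℚ) →
  sumFin (λ i → sumFin (F i)) ≡ sumFin (λ j → sumFin (λ i → F i j))
sumFin-comm {zero}  {k} F = sym (sumFin-zero k)
sumFin-comm {suc m}     F =
  trans (cong (_+_ (sumFin (F zero))) (sumFin-comm (F ∘ suc)))
        (sym (sumFin-distrib-+ (F zero) _))

sumFin-single : ∀ {m} {x : Fin m → ℚ} (s : Fin m) → (∀ i → i ≢ s → x i ≡ 0ℚ) → sumFin x ≡ x s
sumFin-single {suc m} {x} zero    off-s =
  trans (cong (_+_ (x zero)) (trans (sumFin-cong (λ i → off-s (suc i) λ ())) (sumFin-zero m)))
        (+-identityʳ (x zero))
sumFin-single {suc m} {x} (suc s) off-s =
  trans (cong₂ _+_ (off-s zero λ ()) (sumFin-single s (λ i i≢s → off-s (suc i) (i≢s ∘ suc-injective))))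
        (+-identityˡ (x (suc s)))

sumFin₂ : ∀ {m k} → (Fin m → Fin k → ℚ) → ℚ
sumFin₂ F = sumFin (λ i → sumFin (F i))

sumFin₂-cong : ∀ {m k} {F G : Fin m → Fin k → ℚ} → (∀ i j → F i j ≡ G i j) → sumFin₂ F ≡ sumFin₂ G
sumFin₂-cong F≗G = sumFin-cong (sumFin-cong ∘ F≗G)

sumFin₂-distrib-minus : ∀ {m k} (F G : Fin m → Fin k → ℚ) →
  sumFin₂ (λ i j → F i j - G i j) ≡ sumFin₂ F - sumFin₂ G
sumFin₂-distrib-minus F G =
  trans (sumFin-cong (λ i → sumFin-distrib-minus (F i) (G i)))
        (sumFin-distrib-minus (λ i → sumFin (F i)) (λ i → sumFin (G i)))

*-distribˡ-sumFin₂ : ∀ {m k} q (F : Fin m → Fin k → ℚ) → q * sumFin₂ F ≡ sumFin₂ (λ i j → q * F i j)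
*-distribˡ-sumFin₂ q F =
  trans (*-distribˡ-sumFin q (λ i → sumFin (F i))) (sumFin-cong (λ i → *-distribˡ-sumFin q (F i)))

sumFin₂-mono-≤ : ∀ {m k} {F G : Fin m → Fin k → ℚ} → (∀ i j → F i j ≤ G i j) → sumFin₂ F ≤ sumFin₂ G
sumFin₂-mono-≤ F≤G = sumFin-mono-≤ (sumFin-mono-≤ ∘ F≤G)

if-zero-float : (φ : ℚ → ℚ) → φ 0ℚ ≡ 0ℚ →
  ∀ b {x} → φ (if b then x else 0ℚ) ≡ (if b then φ x else 0ℚ)
if-zero-float φ φ0 true  = refl
if-zero-float φ φ0 false = φ0

if-zero-float₂ : (φ : ℚ → ℚ → ℚ) → φ 0ℚ 0ℚ ≡ 0ℚ →
  ∀ b {x y} → φ (if b then x else 0ℚ) (if b then y else 0ℚ) ≡ (if b then φ x y else 0ℚ)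
if-zero-float₂ φ φ00 true  = refl
if-zero-float₂ φ φ00 false = φ00

if-zero-sumFin : ∀ {m} b (x : Fin m → ℚ) →
  (if b then sumFin x else 0ℚ) ≡ sumFin (λ i → if b then x i else 0ℚ)
if-zero-sumFin     true  x = refl
if-zero-sumFin {m} false x = sym (sumFin-zero m)

if-zero-mono-≤ : ∀ b {x y} → (b ≡ true → x ≤ y) → (if b then x else 0ℚ) ≤ (if b then y else 0ℚ)
if-zero-mono-≤ true  x≤y = x≤y refl
if-zero-mono-≤ false _   = ≤-refl

if-zero-⊆-≤ : ∀ b b' {x y} → (b ≡ true → b' ≡ true) → (b ≡ true → x ≤ y) → (b' ≡ true → 0ℚ ≤ y) →
  (if b then x else 0ℚ) ≤ (if b' then y else 0ℚ)
if-zero-⊆-≤ true  true  _    x≤y _   = x≤y refl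
if-zero-⊆-≤ true  false b⊆b' _   _   with () ← b⊆b' refl
if-zero-⊆-≤ false true  _    _   0≤y = 0≤y refl
if-zero-⊆-≤ false false _    _   _   = ≤-refl

netFlow : ∀ {n} → ArcVec n → ArcVec n
netFlow g u v = g u v - g v u

sumIn : ∀ {n} → VSet n → (Fin n → ℚ) → ℚ
sumIn S x = sumFin (λ v → if S v then x v else 0ℚ)

module _ {n : ℕ} (S : VSet n) where

  sumIn-cong : ∀ {x y : Fin n → ℚ} → (∀ v → x v ≡ y v) → sumIn S x ≡ sumIn S y
  sumIn-cong x≗y = sumFin-cong (λ v → cong (λ z → if S v then z else 0ℚ) (x≗y v))

  sumIn-distrib-+ : ∀ (x y : Fin n → ℚ) → sumIn S (λ v → x v + y v) ≡ sumIn S x + sumIn S y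
  sumIn-distrib-+ x y =
    trans (sumFin-cong (λ v → sym (if-zero-float₂ _+_ refl (S v))))
          (sumFin-distrib-+ (λ v → if S v then x v else 0ℚ) (λ v → if S v then y v else 0ℚ))

  sumIn-divergence : (F : Fin n → Fin n → ℚ) →
    sumIn S (λ v → sumFin (F v) - sumFin (λ w → F w v))
      ≡ sumFin₂ (λ u v → if leaves S u v then F u v - F v u else 0ℚ)
  sumIn-divergence F = begin
    sumIn S (λ v → sumFin (F v) - sumFin (λ w → F w v))
      ≡⟨ sumFin-cong (λ u → trans (sym (if-zero-float₂ _-_ refl (S u)))
                                  (cong₂ _-_ (if-zero-sumFin (S u) (F u)) (if-zero-sumFin (S u) (λ w → F w u)))) ⟩
    sumFin (λ u → sumFin (Out u) - sumFin (In u))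
      ≡⟨ sumFin-distrib-minus (λ u → sumFin (Out u)) (λ u → sumFin (In u)) ⟩
    sumFin₂ Out - sumFin₂ In
      ≡⟨ cong (sumFin₂ Out -_) (sumFin-comm In) ⟩
    sumFin₂ Out - sumFin₂ (λ u v → In v u)
      ≡⟨ sumFin₂-distrib-minus Out (λ u v → In v u) ⟨
    sumFin₂ (λ u v → Out u v - In v u)
      ≡⟨ sumFin₂-cong (λ u v → indicator-difference (S u) (S v) (F u v)) ⟩
    sumFin₂ (λ u v → Leave u v - Enter u v)
      ≡⟨ sumFin₂-distrib-minus Leave Enter ⟩
    sumFin₂ Leave - sumFin₂ Enter
      ≡⟨ cong (sumFin₂ Leave -_) (sumFin-comm Enter) ⟩
    sumFin₂ Leave - sumFin₂ (λ u v → Enter v u)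
      ≡⟨ sumFin₂-distrib-minus Leave (λ u v → Enter v u) ⟨
    sumFin₂ (λ u v → Leave u v - Enter v u)
      ≡⟨ sumFin₂-cong (λ u v → if-zero-float₂ _-_ refl (leaves S u v)) ⟩
    sumFin₂ (λ u v → if leaves S u v then F u v - F v u else 0ℚ) ∎
    where
    open ≡-Reasoning
    Out In Leave Enter : Fin n → Fin n → ℚ
    Out   u v = if S u then F u v else 0ℚ
    In    u v = if S u then F v u else 0ℚ
    Leave u v = if leaves S u v then F u v else 0ℚ
    Enter u v = if leaves S v u then F u v else 0ℚ

    indicator-difference : ∀ x y q →
      (if x then q else 0ℚ) - (if y then q else 0ℚ)
        ≡ (if x ∧ not y then q else 0ℚ) - (if y ∧ not x then q else 0ℚ)
    indicator-difference true  true  q = +-inverseʳ q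
    indicator-difference true  false q = refl
    indicator-difference false true  q = refl
    indicator-difference false false q = refl

  sumIn-netOut : (a : Adj n) → (∀ u v → a u v ≡ a v u) → (g : ArcVec n) →
    sumIn S (netOut a g) ≡ cutCap a (netFlow g) S
  sumIn-netOut a a-sym g =
    trans (sumIn-divergence (λ u v → if a u v then g u v else 0ℚ)) (sumFin₂-cong pointwise)
    where
    masked-net : ∀ x ℓ {p q} →
      (if ℓ then (if x then p else 0ℚ) - (if x then q else 0ℚ) else 0ℚ) ≡ (if x ∧ ℓ then p - q else 0ℚ)
    masked-net true  true  = refl
    masked-net true  false = refl
    masked-net false true  = refl
    masked-net false false = refl

    pointwise : ∀ u v →
      (if leaves S u v then (if a u v then g u v else 0ℚ) - (if a v u then g v u else 0ℚ) else 0ℚ)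
        ≡ (if a u v ∧ leaves S u v then netFlow g u v else 0ℚ)
    pointwise u v rewrite a-sym v u = masked-net (a u v) (leaves S u v)

  sumIn-stDemand : ∀ τ s t → S s ≡ true → S t ≡ false → sumIn S (stDemand τ s t) ≡ τ
  sumIn-stDemand τ s t s∈S t∉S = trans (sumFin-single s off-s) at-s
    where
    off-s : ∀ v → v ≢ s → (if S v then stDemand τ s t v else 0ℚ) ≡ 0ℚ
    off-s v v≢s with v ≟ s
    ... | yes v≡s = contradiction v≡s v≢s
    ... | no _ with v ≟ t
    ...   | yes refl rewrite t∉S = refl
    ...   | no _     = if-eta (S v)
    at-s : (if S s then stDemand τ s t s else 0ℚ) ≡ τ
    at-s with s ≟ s
    ... | yes _  rewrite s∈S = refl
    ... | no s≢s = contradiction refl s≢s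

  cutCap-distrib-minus : ∀ a (k l : ArcVec n) → cutCap a (λ u v → k u v - l u v) S ≡ cutCap a k S - cutCap a l S
  cutCap-distrib-minus a k l =
    trans (sumFin₂-cong (λ u v → sym (if-zero-float₂ _-_ refl (a u v ∧ leaves S u v))))
          (sumFin₂-distrib-minus (λ u v → if a u v ∧ leaves S u v then k u v else 0ℚ)
                             (λ u v → if a u v ∧ leaves S u v then l u v else 0ℚ))

  *-distribˡ-cutCap : ∀ q a (k : ArcVec n) → q * cutCap a k S ≡ cutCap a (λ u v → q * k u v) S
  *-distribˡ-cutCap q a k =
    trans (*-distribˡ-sumFin₂ q (λ u v → if a u v ∧ leaves S u v then k u v else 0ℚ))
          (sumFin₂-cong (λ u v → if-zero-float (q *_) (*-zeroʳ q) (a u v ∧ leaves S u v)))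

  cutCap-mono-≤ : ∀ {a b} {k l : ArcVec n} →
    (∀ u v → leaves S u v ≡ true → (if a u v then k u v else 0ℚ) ≤ (if b u v then l u v else 0ℚ)) →
    cutCap a k S ≤ cutCap b l S
  cutCap-mono-≤ {a} {b} pointwise = sumFin₂-mono-≤ (λ u v → masked (a u v) (b u v) (leaves S u v) (pointwise u v))
    where
    masked : ∀ x y ℓ {p q} → (ℓ ≡ true → (if x then p else 0ℚ) ≤ (if y then q else 0ℚ)) →
      (if x ∧ ℓ then p else 0ℚ) ≤ (if y ∧ ℓ then q else 0ℚ)
    masked x y true  ≤-on-ℓ rewrite ∧-identityʳ x | ∧-identityʳ y = ≤-on-ℓ refl
    masked x y false _      rewrite ∧-zeroʳ x     | ∧-zeroʳ y     = ≤-refl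

leaves⇒∈×∉ : ∀ {n} {S : VSet n} {u v} → leaves S u v ≡ true → S u ≡ true × S v ≡ false
leaves⇒∈×∉ {S = S} {u} {v} uv-leaves with S u | S v | uv-leaves
... | true | false | _ = refl , refl

restrict-∈ : ∀ {n} (a : Adj n) (g : ArcVec n) {u v} → a u v ≡ true → restrict a g u v ≡ g u v
restrict-∈ a g {u} {v} uv∈a = cong (λ b → if b then g u v else 0ℚ) uv∈a

residCap-+ : ∀ {n} (c g k : ArcVec n) u v →
  residCap c (λ x y → g x y + k x y) u v ≡ residCap c g u v - netFlow k u v
residCap-+ c g k u v =
  solve 5 (λ c g₁ g₂ k₁ k₂ → c :- (g₁ :+ k₁) :+ (g₂ :+ k₂) := (c :- g₁ :+ g₂) :- (k₁ :- k₂)) refl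
        (c u v) (g u v) (g v u) (k u v) (k v u)

module _ {n : ℕ} (adj : Adj n) (c : ArcVec n) (ε : ℚ) (S : VSet n) where

  Gi-sym : (∀ u v → adj u v ≡ adj v u) → ∀ f u v → Gi adj c ε f S u v ≡ Gi adj c ε f S v u
  Gi-sym adj-sym f u v =
    cong₂ (λ x y → x ∧ not y) (adj-sym u v)
          (cong₂ (λ x y → x ∧ not y) (xor-comm (S u) (S v))
                 (∨-comm (Uarc adj c ε f S u v) (Uarc adj c ε f S v u)))

  Gi⊆adj : ∀ f {u v} → Gi adj c ε f S u v ≡ true → adj u v ≡ true
  Gi⊆adj f {u} {v} = ∧-conicalˡ (adj u v) _

  Gi-leaving : ∀ f {u v} → leaves S u v ≡ true →
    Gi adj c ε f S u v ≡ adj u v ∧ (f u v ≤ᵇ ((1ℚ - (+ 4 / 1) * ε) * c u v))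
  Gi-leaving f {u} {v} uv-leaves with (u∈S , v∉S) ← leaves⇒∈×∉ {S = S} uv-leaves
    rewrite u∈S | v∉S with adj u v
  ... | true  rewrite ∧-zeroʳ (adj v u) | ∨-identityʳ (f u v ≤ᵇ ((1ℚ - (+ 4 / 1) * ε) * c u v)) = not-involutive _
  ... | false = refl

  Gi-leaving⇒≤ : ∀ f {u v} → leaves S u v ≡ true → Gi adj c ε f S u v ≡ true →
    f u v ≤ (1ℚ - (+ 4 / 1) * ε) * c u v
  Gi-leaving⇒≤ f {u} {v} uv-leaves uv∈Gi =
    ≤ᵇ⇒≤ (Equivalence.from T-≡ (∧-conicalʳ (adj u v) _ (trans (sym (Gi-leaving f uv-leaves)) uv∈Gi)))

  Gi-leaving-cong : ∀ f f' {u v} → leaves S u v ≡ true → f u v ≡ f' u v →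
    Gi adj c ε f S u v ≡ Gi adj c ε f' S u v
  Gi-leaving-cong f f' {u} {v} uv-leaves fuv≡f'uv =
    trans (Gi-leaving f uv-leaves)
          (trans (cong (λ x → adj u v ∧ (x ≤ᵇ ((1ℚ - (+ 4 / 1) * ε) * c u v))) fuv≡f'uv)
                 (sym (Gi-leaving f' uv-leaves)))

module _ {n : ℕ} (adj : Adj n) (c : ArcVec n) (ε : ℚ) (S : VSet n)
         (adj-sym : ∀ u v → adj u v ≡ adj v u) (f : ArcVec n) where

  private
    G : Adj n
    G = Gi adj c ε f S
    r : ArcVec n
    r = G'cap adj c ε f S

    G-sym : ∀ {u v} → G u v ≡ true → G v u ≡ true
    G-sym {u} {v} = trans (Gi-sym adj c ε S adj-sym f v u)

  netFlow-≤-quarter-residual : (∀ u v → adj u v ≡ true → 0ℚ ≤ f u v) →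
    ∀ {g} → (∀ u v → G u v ≡ true → (0ℚ ≤ g u v) × (g u v ≤ ε * c u v)) →
    ∀ {u v} → leaves S u v ≡ true → G u v ≡ true → netFlow g u v ≤ (+ 1 / 4) * r u v
  netFlow-≤-quarter-residual f≥0 {g} g-feasible {u} {v} uv-leaves uv∈G = begin
    g u v - g v u
      ≤⟨ p-q≤p (g u v) (proj₁ (g-feasible v u (G-sym uv∈G))) ⟩
    g u v
      ≤⟨ proj₂ (g-feasible u v uv∈G) ⟩
    ε * c u v
      ≡⟨ solve 2 (λ ε c → ε :* c := con (+ 1 / 4) :* (c :- (con 1ℚ :- con (+ 4 / 1) :* ε) :* c)) refl ε (c u v) ⟩
    (+ 1 / 4) * (c u v - (1ℚ - (+ 4 / 1) * ε) * c u v)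
      ≤⟨ *-monoˡ-≤-nonNeg (+ 1 / 4) (+-monoʳ-≤ (c u v) (neg-antimono-≤ (Gi-leaving⇒≤ adj c ε S f uv-leaves uv∈G))) ⟩
    (+ 1 / 4) * (c u v - f u v)
      ≤⟨ *-monoˡ-≤-nonNeg (+ 1 / 4) (p≤p+q (c u v - f u v) (f≥0 v u (Gi⊆adj adj c ε S f (G-sym uv∈G)))) ⟩
    (+ 1 / 4) * (c u v - f u v + f v u)
      ≡⟨ cong₂ (λ x y → (+ 1 / 4) * (c u v - x + y)) (restrict-∈ G f uv∈G) (restrict-∈ G f (G-sym uv∈G)) ⟨
    (+ 1 / 4) * r u v ∎
    where open ≤-Reasoning

  cutCap-netFlow-≤-quarter : (∀ u v → adj u v ≡ true → 0ℚ ≤ f u v) →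
    ∀ {g} → (∀ u v → G u v ≡ true → (0ℚ ≤ g u v) × (g u v ≤ ε * c u v)) →
    cutCap G (netFlow g) S ≤ (+ 1 / 4) * residCut adj c ε f S
  cutCap-netFlow-≤-quarter f≥0 {g} g-feasible = begin
    cutCap G (netFlow g) S
      ≤⟨ cutCap-mono-≤ S {G} {G} {netFlow g} {λ u v → (+ 1 / 4) * r u v} (λ u v uv-leaves →
           if-zero-mono-≤ (G u v) (netFlow-≤-quarter-residual f≥0 g-feasible uv-leaves)) ⟩
    cutCap G (λ u v → (+ 1 / 4) * r u v) S
      ≡⟨ *-distribˡ-cutCap S (+ 1 / 4) G r ⟨
    (+ 1 / 4) * residCut adj c ε f S ∎
    where open ≤-Reasoning

  module _ (h : ArcVec n) where

    private
      f⁺ : ArcVec n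
      f⁺ u v = f u v + restrict G h u v
      G⁺ : Adj n
      G⁺ = Gi adj c ε f⁺ S

    Gi-augment⊆Gi-leaving : ∀ {u v} → leaves S u v ≡ true → G⁺ u v ≡ true → G u v ≡ true
    Gi-augment⊆Gi-leaving {u} {v} uv-leaves uv∈G⁺ = ¬-not λ uv∉G →
      contradiction (trans (sym uv∈G⁺) (trans (sym (Gi-leaving-cong adj c ε S f f⁺ uv-leaves (sym (f⁺uv≡fuv uv∉G)))) uv∉G))
                    λ ()
      where
      f⁺uv≡fuv : G u v ≡ false → f⁺ u v ≡ f u v
      f⁺uv≡fuv uv∉G = trans (cong (λ b → f u v + (if b then h u v else 0ℚ)) uv∉G) (+-identityʳ (f u v))

    residCap-augment : ∀ {u v} → G u v ≡ true → G⁺ u v ≡ true →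
      G'cap adj c ε f⁺ S u v ≡ r u v - netFlow h u v
    residCap-augment {u} {v} uv∈G uv∈G⁺ = begin
      residCap c (restrict G⁺ f⁺) u v
        ≡⟨ cong₂ (λ x y → c u v - x + y) (split uv∈G uv∈G⁺)
                 (split (G-sym uv∈G) (trans (Gi-sym adj c ε S adj-sym f⁺ v u) uv∈G⁺)) ⟩
      residCap c (λ x y → restrict G f x y + restrict G h x y) u v
        ≡⟨ residCap-+ c (restrict G f) (restrict G h) u v ⟩
      r u v - netFlow (restrict G h) u v
        ≡⟨ cong₂ (λ x y → r u v - (x - y)) (restrict-∈ G h uv∈G) (restrict-∈ G h (G-sym uv∈G)) ⟩
      r u v - netFlow h u v ∎
      where
      open ≡-Reasoning
      split : ∀ {x y} → G x y ≡ true → G⁺ x y ≡ true →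
        restrict G⁺ f⁺ x y ≡ restrict G f x y + restrict G h x y
      split {x} {y} xy∈G xy∈G⁺ =
        trans (restrict-∈ G⁺ f⁺ xy∈G⁺) (cong (_+ restrict G h x y) (sym (restrict-∈ G f xy∈G)))

    residCut-augment-≤ : (∀ u v → G u v ≡ true → (0ℚ ≤ h u v) × (h u v ≤ r u v)) →
      residCut adj c ε f⁺ S ≤ residCut adj c ε f S - cutCap G (netFlow h) S
    residCut-augment-≤ h-feasible = begin
      residCut adj c ε f⁺ S
        ≤⟨ cutCap-mono-≤ S {G⁺} {G} {G'cap adj c ε f⁺ S} {λ u v → r u v - netFlow h u v} (λ u v uv-leaves →
             if-zero-⊆-≤ (G⁺ u v) (G u v) (Gi-augment⊆Gi-leaving uv-leaves)
               (λ uv∈G⁺ → ≤-reflexive (residCap-augment (Gi-augment⊆Gi-leaving uv-leaves uv∈G⁺) uv∈G⁺))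
               residual-minus-netFlow-nonneg) ⟩
      cutCap G (λ u v → r u v - netFlow h u v) S
        ≡⟨ cutCap-distrib-minus S G r (netFlow h) ⟩
      residCut adj c ε f S - cutCap G (netFlow h) S ∎
      where
      open ≤-Reasoning
      residual-minus-netFlow-nonneg : ∀ {u v} → G u v ≡ true → 0ℚ ≤ r u v - netFlow h u v
      residual-minus-netFlow-nonneg {u} {v} uv∈G = begin
        0ℚ
          ≡⟨ +-inverseʳ (h u v) ⟨
        h u v - h u v
          ≤⟨ +-monoˡ-≤ _ (proj₂ (h-feasible u v uv∈G)) ⟩
        r u v - h u v
          ≤⟨ p≤p+q (r u v - h u v) (proj₁ (h-feasible v u (G-sym uv∈G))) ⟩
        r u v - h u v + h v u
          ≡⟨ solve 3 (λ r x y → r :- x :+ y := r :- (x :- y)) refl (r u v) (h u v) (h v u) ⟩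
        r u v - netFlow h u v ∎

cutCap-netFlow-split : ∀ {n} (a : Adj n) → (∀ u v → a u v ≡ a v u) →
  ∀ {S : VSet n} {s t τ} {h g : ArcVec n} {d : Fin n → ℚ} → S s ≡ true → S t ≡ false →
  (∀ v → netOut a h v ≡ d v) → (∀ v → netOut a g v ≡ stDemand τ s t v - d v) →
  cutCap a (netFlow h) S + cutCap a (netFlow g) S ≡ τ
cutCap-netFlow-split a a-sym {S} {s} {t} {τ} {h} {g} {d} s∈S t∉S h-routes g-routes = begin
  cutCap a (netFlow h) S + cutCap a (netFlow g) S
    ≡⟨ cong₂ _+_ (sumIn-netOut S a a-sym h) (sumIn-netOut S a a-sym g) ⟨
  sumIn S (netOut a h) + sumIn S (netOut a g)
    ≡⟨ sumIn-distrib-+ S (netOut a h) (netOut a g) ⟨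
  sumIn S (λ v → netOut a h v + netOut a g v)
    ≡⟨ sumIn-cong S (λ v → trans (cong₂ _+_ (h-routes v) (g-routes v))
                                 (solve 2 (λ x y → y :+ (x :- y) := x) refl (stDemand τ s t v) (d v))) ⟩
  sumIn S (stDemand τ s t)
    ≡⟨ sumIn-stDemand S τ s t s∈S t∉S ⟩
  τ ∎
  where open ≡-Reasoning

three-quarters : ∀ C H {Γ} → H + Γ ≡ ½ * C → Γ ≤ (+ 1 / 4) * C → C - H ≤ (+ 3 / 4) * C
three-quarters C H {Γ} H+Γ≡C/2 Γ≤C/4 = begin
  C - H
    ≡⟨ solve 3 (λ C H Γ → C :- H := C :- (H :+ Γ) :+ Γ) refl C H Γ ⟩
  C - (H + Γ) + Γ
    ≡⟨ cong (λ x → C - x + Γ) H+Γ≡C/2 ⟩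
  C - ½ * C + Γ
    ≤⟨ +-monoʳ-≤ (C - ½ * C) Γ≤C/4 ⟩
  C - ½ * C + (+ 1 / 4) * C
    ≡⟨ solve 1 (λ C → C :- con ½ :* C :+ con (+ 1 / 4) :* C := con (+ 3 / 4) :* C) refl C ⟩
  (+ 3 / 4) * C ∎
  where open ≤-Reasoning

lemma5 : (n : ℕ) (adj : Adj n) (c : ArcVec n)
  → (∀ u v → adj u v ≡ adj v u)
  → (∀ u v → adj u v ≡ true → c u v ≡ c v u)
  → (∀ u v → adj u v ≡ true → 0ℚ < c u v)
  → (s t : Fin n) → s ≢ t
  → (ε : ℚ) → 0ℚ < ε
  → (f : ArcVec n) → (∀ u v → adj u v ≡ true → 0ℚ ≤ f u v)
  → (S : VSet n) → S s ≡ true → S t ≡ false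
  → (h : ArcVec n)
  → (∀ u v → Gi adj c ε f S u v ≡ true → (0ℚ ≤ h u v) × (h u v ≤ G'cap adj c ε f S u v))
  → (d : Fin n → ℚ)
  → (∀ v → netOut (Gi adj c ε f S) h v ≡ d v)
  → Σ (ArcVec n) (λ g →
       (∀ u v → Gi adj c ε f S u v ≡ true → (0ℚ ≤ g u v) × (g u v ≤ ε * c u v))
       × (∀ v → netOut (Gi adj c ε f S) g v
                  ≡ stDemand (½ * residCut adj c ε f S) s t v - d v))
  → residCut adj c ε (λ u v → f u v + restrict (Gi adj c ε f S) h u v) S
      ≤ (+ 3 / 4) * residCut adj c ε f S
lemma5 n adj c adj-sym _ _ s t _ ε _ f f≥0 S s∈S t∉S h h-feasible d h-routes (g , g-feasible , g-routes) = begin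
  residCut adj c ε (λ u v → f u v + restrict G h u v) S
    ≤⟨ residCut-augment-≤ adj c ε S adj-sym f h h-feasible ⟩
  C - cutCap G (netFlow h) S
    ≤⟨ three-quarters C (cutCap G (netFlow h) S)
                      (cutCap-netFlow-split G (Gi-sym adj c ε S adj-sym f) s∈S t∉S h-routes g-routes)
                      (cutCap-netFlow-≤-quarter adj c ε S adj-sym f f≥0 g-feasible) ⟩
  (+ 3 / 4) * C ∎
  where
  open ≤-Reasoning
  G : Adj n
  G = Gi adj c ε f S
  C : ℚ
  C = residCut adj c ε f S
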